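{- For an arbitrary vertex $z$ of a $\mathcal{T}_7$-free tournament $T'$, the set $V_3(z)$ is 2-in-dominated by $V_2(z)$.
   Context: A tournament is an orientation of a complete graph; $u\to v$ denotes the arc from $u$ to $v$. $\mathcal{T}_7$ is the family of $7$-vertex tournaments with no transitive subtournament on $5$ vertices; a tournament is $\mathcal{T}_7$-free if it has no $7$-vertex subtournament isomorphic to a member of $\mathcal{T}_7$. For a vertex $z$ and $\ell\ge1$, $V_\ell(z)$ is the set of vertices $v$ such that the shortest directed path from $v$ to $z$ has length exactly $\ell-1$. For disjoint vertex sets $S,Z$, $Z$ in-dominates $S$ if for every $s\in S$ there is $z'\in Z$ with $s\to z'$; $Z$ 2-in-dominates $S$ if some $Z'\subseteq Z$ with $|Z'|\le 2$ in-dominates $S$. -}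

module Defs where

open import Data.Nat using (ℕ; zero; suc; _≤_; _<_)
open import Data.Fin using (Fin) renaming (_<_ to _<ᶠ_)
open import Data.Bool using (Bool; true; false; not)
open import Data.List using (List; length)
open import Data.List.Membership.Propositional using (_∈_)
open import Data.Product using (Σ; ∃; _×_; _,_)
open import Relation.Binary.PropositionalEquality using (_≡_; _≢_)
open import Relation.Nullary using (¬_)
open import Data.Empty using (⊥)
open import Function.Definitions using (Injective)

-- A tournament on the vertex set Fin n: adj u v ≡ true means u → v.
record Tournament (n : ℕ) : Set where
  field
    adj     : Fin n → Fin n → Bool
    irrefl  : ∀ u → adj u u ≡ false
    tourn   : ∀ u v → u ≢ v → adj u v ≡ not (adj v u)

open Tournament public

Arc : ∀ {n} → Tournament n → Fin n → Fin n → Set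
Arc T u v = adj T u v ≡ true

HasTT5 : ∀ {n} → Tournament n → Set
HasTT5 {n} T = Σ (Fin 5 → Fin n) λ g →
  Injective _≡_ _≡_ g × (∀ i j → i <ᶠ j → Arc T (g i) (g j))

In𝒯₇ : Tournament 7 → Set
In𝒯₇ S = ¬ HasTT5 S

EmbedsAsSub : ∀ {m n} → Tournament m → Tournament n → Set
EmbedsAsSub {m} {n} S T = Σ (Fin m → Fin n) λ f →
  Injective _≡_ _≡_ f × (∀ i j → adj S i j ≡ adj T (f i) (f j))

𝒯₇-free : ∀ {n} → Tournament n → Set
𝒯₇-free T = ¬ (Σ (Tournament 7) λ S → In𝒯₇ S × EmbedsAsSub S T)

data Walk {n} (T : Tournament n) : ℕ → Fin n → Fin n → Set where
  here : ∀ {u} → Walk T zero u u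
  step : ∀ {k u w v} → Arc T u w → Walk T k w v → Walk T (suc k) u v

Dist : ∀ {n} → Tournament n → Fin n → Fin n → ℕ → Set
Dist T v z d = Walk T d v z × (∀ k → k < d → ¬ Walk T k v z)

-- V_ℓ(z), for ℓ ≥ 1, written with ℓ = suc d: shortest path length exactly d = ℓ - 1
V : ∀ {n} → Tournament n → (ℓ : ℕ) → Fin n → Fin n → Set
V T zero    z v = ⊥
V T (suc d) z v = Dist T v z d

InDominates : ∀ {n} → Tournament n → (Fin n → Set) → (Fin n → Set) → Set
InDominates {n} T Z S = ∀ s → S s → Σ (Fin n) λ z' → Z z' × Arc T s z'

TwoInDominates : ∀ {n} → Tournament n → (Fin n → Set) → (Fin n → Set) → Set
TwoInDominates {n} T Z S = Σ (List (Fin n)) λ Z' →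
  length Z' ≤ 2 × (∀ x → x ∈ Z' → Z x) × InDominates T (λ x → x ∈ Z') S

module Submission where

-- Let z be a vertex of a 𝒯₇-free tournament T, let A = V₂(z) be the in-neighbours
-- of z and let B be the out-neighbours of z that have an out-neighbour in A; the
-- set V₃(z) is contained in B.  Starting from A and discarding redundant members
-- we obtain an irredundant subset H ⊆ A still in-dominating B: every a ∈ H has a
-- private target b ∈ B with b → a and a' → b for all other a' ∈ H.  If H had three
-- members a₁ a₂ a₃ with private targets b₁ b₂ b₃, the seven vertices z, aᵢ, bᵢ
-- would carry the fifteen forced arcs aᵢ → z → bᵢ → aᵢ and aⱼ → bᵢ (i ≠ j); we
-- check by a finite computation that these forced arcs leave no room for a
-- transitive subtournament on five vertices, so the seven vertices span a member
-- of 𝒯₇, contradicting 𝒯₇-freeness.  Hence |H| ≤ 2, and H witnesses the claim.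

open import Defs
open import Data.Nat using (ℕ; zero; suc; z≤n; s≤s) renaming (_≤_ to _≤ℕ_; _<_ to _<ℕ_)
open import Data.Nat.Induction using (<-wellFounded)
open import Data.Fin using (Fin; zero; suc; #_; _≟_; _<_)
open import Data.Fin.Properties using (any?; all?)
open import Data.Bool using (true; not)
open import Data.Bool.Properties using (¬-not) renaming (_≟_ to _≟ᵇ_)
open import Data.List using (List; []; _∷_; length; filter; allFin)
open import Data.List.Properties using (filter-notAll)
open import Data.List.Membership.Propositional using (_∈_; find; lose)
open import Data.List.Membership.Propositional.Properties using (∈-allFin; ∈-filter⁺; ∈-filter⁻)
import Data.List.Membership.DecPropositional as DecMembership
open import Data.List.Relation.Binary.Subset.Propositional using (_⊆_)
open import Data.List.Relation.Unary.All as All using (All; []; _∷_)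
open import Data.List.Relation.Unary.All.Properties using (¬All⇒Any¬)
open import Data.List.Relation.Unary.Any as Any using (Any; here; there)
open import Data.List.Relation.Unary.AllPairs using (_∷_)
open import Data.List.Relation.Unary.Unique.Propositional using (Unique)
open import Data.List.Relation.Unary.Unique.Propositional.Properties using (allFin⁺; filter⁺)
open import Data.Vec using ([]; _∷_; lookup)
open import Data.Product using (Σ-syntax; ∃-syntax; _×_; _,_; proj₁; proj₂)
open import Data.Product.Properties using (≡-dec)
open import Data.Sum using (_⊎_; inj₁; inj₂; [_,_])
open import Data.Unit using (⊤; tt)
open import Data.Empty using (⊥-elim)
open import Function using (_∘_)
open import Function.Definitions using (Injective)
open import Induction.WellFounded using (Acc; acc)
open import Relation.Binary.Definitions using (DecidableEquality)
open import Relation.Binary.PropositionalEquality using (_≡_; _≢_; refl; sym; trans; cong; subst; ≢-sym)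
open import Relation.Nullary using (¬_; Dec; yes; no; ¬?; contradiction)
open import Relation.Nullary.Decidable using (_×-dec_; _⊎-dec_; _→-dec_; toWitness; toWitnessFalse)

module _ {n : ℕ} (T : Tournament n) where

  arc-irreflexive : ∀ {u} → ¬ Arc T u u
  arc-irreflexive {u} uu = contradiction (trans (sym uu) (irrefl T u)) λ ()

  arc-distinct : ∀ {u v} → Arc T u v → u ≢ v
  arc-distinct uv refl = arc-irreflexive uv

  arc-asymmetric : ∀ {u v} → Arc T u v → ¬ Arc T v u
  arc-asymmetric {u} {v} uv vu with u ≟ v
  ... | yes refl = arc-irreflexive uv
  ... | no u≢v = contradiction (trans (sym uv) (trans (tourn T u v u≢v) (cong not vu))) λ ()

  arc-or-reverse : ∀ {u v} → u ≢ v → ¬ Arc T u v → Arc T v u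
  arc-or-reverse {u} {v} u≢v ¬uv = trans (tourn T v u (≢-sym u≢v)) (cong not (¬-not ¬uv))

  arc? : ∀ u v → Dec (Arc T u v)
  arc? u v = adj T u v ≟ᵇ true

  induced : ∀ {m} (f : Fin m → Fin n) → Injective _≡_ _≡_ f → Tournament m
  induced f f-inj = record
    { adj    = λ i j → adj T (f i) (f j)
    ; irrefl = λ i → irrefl T (f i)
    ; tourn  = λ i j i≢j → tourn T (f i) (f j) (i≢j ∘ f-inj)
    }

  induced-embeds : ∀ {m} (f : Fin m → Fin n) (f-inj : Injective _≡_ _≡_ f) →
                   EmbedsAsSub (induced f f-inj) T
  induced-embeds f f-inj = f , f-inj , λ _ _ → refl

ArcPattern : ℕ → Set
ArcPattern m = List (Fin m × Fin m)

_≟ₚ_ : ∀ {m} → DecidableEquality (Fin m × Fin m)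
_≟ₚ_ = ≡-dec _≟_ _≟_

Realizes : ∀ {m n} → Tournament n → (Fin m → Fin n) → ArcPattern m → Set
Realizes T f ks = All (λ e → Arc T (f (proj₁ e)) (f (proj₂ e))) ks

module _ {m : ℕ} where
  open DecMembership (_≟ₚ_ {m}) using (_∉_; _∈?_)

  Reach : ArcPattern m → Fin m → Fin m → Set
  Reach ks i j = (i , j) ∈ ks ⊎ ∃[ k ] ((i , k) ∈ ks × (k , j) ∈ ks)

  reach? : ∀ ks i j → Dec (Reach ks i j)
  reach? ks i j = ((i , j) ∈? ks) ⊎-dec any? λ k → ((i , k) ∈? ks) ×-dec ((k , j) ∈? ks)

  -- Any two distinct positions are linked by a short prescribed path; this forces
  -- every realizing map to be injective.
  Separated : ArcPattern m → Set
  Separated ks = ∀ i j → i ≢ j → Reach ks i j ⊎ Reach ks j i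

  separated? : ∀ ks → Dec (Separated ks)
  separated? ks = all? λ i → all? λ j → ¬? (i ≟ j) →-dec (reach? ks i j ⊎-dec reach? ks j i)

  Allowed : ArcPattern m → Fin m → Fin m → Set
  Allowed ks i j = i ≢ j × (j , i) ∉ ks

  allowed? : ∀ ks i j → Dec (Allowed ks i j)
  allowed? ks i j = ¬? (i ≟ j) ×-dec ¬? ((j , i) ∈? ks)

  Chain : (Fin m → Fin m → Set) → ℕ → (Fin m → Set) → Set
  Chain R zero    P = ⊤
  Chain R (suc k) P = ∃[ v ] (P v × Chain R k (λ u → P u × R v u))

  chain? : ∀ {R P} → (∀ i j → Dec (R i j)) → ∀ k → (∀ i → Dec (P i)) → Dec (Chain R k P)
  chain? R? zero    P? = yes tt
  chain? R? (suc k) P? = any? λ v → P? v ×-dec chain? R? k (λ u → P? u ×-dec R? v u)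

  chain-complete : ∀ {R P k} (g : Fin k → Fin m) → (∀ i → P (g i)) →
                   (∀ i j → i < j → R (g i) (g j)) → Chain R k P
  chain-complete {k = zero}  g inP ordered = tt
  chain-complete {k = suc k} g inP ordered =
    g zero , inP zero ,
    chain-complete (g ∘ suc) (λ i → inP (suc i) , ordered zero (suc i) (s≤s z≤n))
                   (λ i j i<j → ordered (suc i) (suc j) (s≤s i<j))

  module _ {n : ℕ} (T : Tournament n) {f : Fin m → Fin n} {ks : ArcPattern m}
           (realized : Realizes T f ks) where

    reach-distinct : ∀ {i j} → Reach ks i j → f i ≢ f j
    reach-distinct (inj₁ ij) = arc-distinct T (All.lookup realized ij)
    reach-distinct (inj₂ (k , ik , kj)) fi≡fj =
      arc-asymmetric T (All.lookup realized ik)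
        (subst (Arc T (f k)) (sym fi≡fj) (All.lookup realized kj))

    separated-injective : Separated ks → Injective _≡_ _≡_ f
    separated-injective separated {i} {j} fi≡fj with i ≟ j
    ... | yes i≡j = i≡j
    ... | no i≢j = ⊥-elim ([ (λ r → reach-distinct r fi≡fj) , (λ r → reach-distinct r (sym fi≡fj)) ]
                             (separated i j i≢j))

    realized-allowed : ∀ {i j} → Arc T (f i) (f j) → Allowed ks i j
    realized-allowed ij = (λ { refl → arc-irreflexive T ij }) ,
                          (λ ji → arc-asymmetric T ij (All.lookup realized ji))

    pattern-excludes-TT5 : (f-inj : Injective _≡_ _≡_ f) →
                           ¬ Chain (Allowed ks) 5 (λ _ → ⊤) → ¬ HasTT5 (induced T f f-inj)
    pattern-excludes-TT5 f-inj no-chain (g , _ , ordered) =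
      no-chain (chain-complete g (λ _ → tt) (λ i j i<j → realized-allowed (ordered i j i<j)))

-- The obstruction on positions 0 = z, 1 2 3 = a₁ a₂ a₃, 4 5 6 = b₁ b₂ b₃:
-- aᵢ → z, z → bᵢ, bᵢ → aᵢ and aⱼ → bᵢ for j ≠ i.
obstruction : ArcPattern 7
obstruction =
  (# 1 , # 0) ∷ (# 2 , # 0) ∷ (# 3 , # 0) ∷
  (# 0 , # 4) ∷ (# 0 , # 5) ∷ (# 0 , # 6) ∷
  (# 4 , # 1) ∷ (# 5 , # 2) ∷ (# 6 , # 3) ∷
  (# 1 , # 5) ∷ (# 1 , # 6) ∷ (# 2 , # 4) ∷ (# 2 , # 6) ∷ (# 3 , # 4) ∷ (# 3 , # 5) ∷ []

-- Finite checks: the obstruction separates its vertices, and every 5-set contains a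
-- directed cycle of forced arcs, so no five positions can be transitively ordered.
obstruction-separated : Separated obstruction
obstruction-separated = toWitness {a? = separated? obstruction} tt

obstruction-no-chain : ¬ Chain (Allowed obstruction) 5 (λ _ → ⊤)
obstruction-no-chain = toWitnessFalse {a? = chain? (allowed? obstruction) 5 (λ _ → yes tt)} tt

obstruction-forbidden : ∀ {n} (T : Tournament n) → 𝒯₇-free T →
                        (f : Fin 7 → Fin n) → ¬ Realizes T f obstruction
obstruction-forbidden T free f realized =
  free (induced T f f-inj , pattern-excludes-TT5 T realized f-inj obstruction-no-chain ,
        induced-embeds T f f-inj)
  where f-inj = separated-injective T realized obstruction-separated

module Cover {X Y : Set} (R : Y → X → Set) (R? : ∀ y x → Dec (R y x))
             (_≟ₓ_ : DecidableEquality X) where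

  Covers : List Y → List X → Set
  Covers ys H = All (λ y → Any (R y) H) ys

  covers? : ∀ ys H → Dec (Covers ys H)
  covers? ys H = All.all? (λ y → Any.any? (R? y) H) ys

  PrivateTarget : List Y → List X → X → Set
  PrivateTarget ys H a = ∃[ y ] (y ∈ ys × R y a × (∀ {a'} → a' ∈ H → R y a' → a' ≡ a))

  _without_ : List X → X → List X
  H without a = filter (λ x → ¬? (x ≟ₓ a)) H

  without-shorter : ∀ {a H} → a ∈ H → length (H without a) <ℕ length H
  without-shorter {a} a∈H =
    filter-notAll (λ x → ¬? (x ≟ₓ a)) _ (Any.map (λ a≡x x≢a → x≢a (sym a≡x)) a∈H)

  irredundant-private : ∀ {ys H} → Covers ys H → ¬ Any (λ a → Covers ys (H without a)) H →
                        ∀ {a} → a ∈ H → PrivateTarget ys H a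
  irredundant-private {ys} {H} covers irredundant {a} a∈H
    with find (¬All⇒Any¬ (λ y → Any.any? (R? y) (H without a)) ys
                          (λ covers' → irredundant (lose a∈H covers')))
  ... | y , y∈ys , uncovered with find (All.lookup covers y∈ys)
  ... | a₀ , a₀∈H , ya₀ = y , y∈ys , subst (R y) (only a₀∈H ya₀) ya₀ , only
    where
    only : ∀ {a'} → a' ∈ H → R y a' → a' ≡ a
    only {a'} a'∈H ya' with a' ≟ₓ a
    ... | yes a'≡a = a'≡a
    ... | no a'≢a = contradiction (lose (∈-filter⁺ (λ x → ¬? (x ≟ₓ a)) a'∈H a'≢a) ya') uncovered

  irredundant-subcover : ∀ ys H → Unique H → Covers ys H →
    Σ[ H' ∈ List X ] (H' ⊆ H × Unique H' × Covers ys H' × (∀ {a} → a ∈ H' → PrivateTarget ys H' a))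
  irredundant-subcover ys H = prune H (<-wellFounded (length H))
    where
    prune : ∀ H → Acc _<ℕ_ (length H) → Unique H → Covers ys H →
      Σ[ H' ∈ List X ] (H' ⊆ H × Unique H' × Covers ys H' × (∀ {a} → a ∈ H' → PrivateTarget ys H' a))
    prune H (acc smaller) unique covers with Any.any? (λ a → covers? ys (H without a)) H
    ... | no irredundant = H , (λ x∈H → x∈H) , unique , covers , irredundant-private covers irredundant
    ... | yes redundant with find redundant
    ... | a , a∈H , covers'
      with prune (H without a) (smaller (without-shorter a∈H)) (filter⁺ _ unique) covers'
    ... | H' , H'⊆ , unique' , covers'' , private' =
      H' , (λ x∈H' → proj₁ (∈-filter⁻ _ {xs = H} (H'⊆ x∈H'))) ,
      unique' , covers'' , private'

module _ {n : ℕ} (T : Tournament n) (z : Fin n) where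
  open Cover (Arc T) (arc? T) _≟_

  -- A = V₂(z), listed without repetition.
  inNeighbours : List (Fin n)
  inNeighbours = filter (λ a → arc? T a z) (allFin n)

  Target : Fin n → Set
  Target s = Arc T z s × Any (Arc T s) inNeighbours

  targets : List (Fin n)
  targets = filter (λ s → arc? T z s ×-dec Any.any? (arc? T s) inNeighbours) (allFin n)

  in-neighbour : ∀ {a} → a ∈ inNeighbours → Arc T a z
  in-neighbour a∈A = proj₂ (∈-filter⁻ (λ a → arc? T a z) {xs = allFin n} a∈A)

  target : ∀ {s} → s ∈ targets → Target s
  target s∈B = proj₂ (∈-filter⁻ (λ s → arc? T z s ×-dec Any.any? (arc? T s) inNeighbours)
                                {xs = allFin n} s∈B)

  targets-covered : Covers targets inNeighbours
  targets-covered = All.tabulate (proj₂ ∘ target)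

  V₂-intro : ∀ {a} → Arc T a z → V T 2 z a
  V₂-intro az = step az here , λ { zero _ here → arc-irreflexive T az ; (suc k) (s≤s ()) }

  V₃-target : ∀ {s} → V T 3 z s → s ∈ targets
  V₃-target {s} (step {w = w} sw (step wz here) , shortest) =
    ∈-filter⁺ _ (∈-allFin s) (arc-or-reverse T s≢z ¬sz ,
                              lose (∈-filter⁺ _ (∈-allFin w) wz) sw)
    where
    s≢z : s ≢ z
    s≢z refl = shortest 0 (s≤s z≤n) here
    ¬sz : ¬ Arc T s z
    ¬sz sz = shortest 1 (s≤s (s≤s z≤n)) (step sz here)

  beats-private-target : ∀ {H a a' b} → a' ∈ H → Arc T a' z → a' ≢ a → Arc T z b →
                         (∀ {x} → x ∈ H → Arc T b x → x ≡ a) → Arc T a' b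
  beats-private-target a'∈H a'z a'≢a zb only =
    arc-or-reverse T (λ { refl → arc-asymmetric T a'z zb }) (λ ba' → a'≢a (only a'∈H ba'))

  -- In a 𝒯₇-free tournament an irredundant cover of the targets by in-neighbours
  -- of z has at most two members: three would realize the obstruction.
  at-most-two : 𝒯₇-free T → ∀ {H} → Unique H → (∀ {a} → a ∈ H → Arc T a z) →
                (∀ {a} → a ∈ H → PrivateTarget targets H a) → length H ≤ℕ 2
  at-most-two free {[]}              _ _ _ = z≤n
  at-most-two free {_ ∷ []}          _ _ _ = s≤s z≤n
  at-most-two free {_ ∷ _ ∷ []}      _ _ _ = s≤s (s≤s z≤n)
  at-most-two free {a₁ ∷ a₂ ∷ a₃ ∷ H} ((a₁≢a₂ ∷ a₁≢a₃ ∷ _) ∷ (a₂≢a₃ ∷ _) ∷ _) inA private'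
    with private' (here refl) | private' (there (here refl)) | private' (there (there (here refl)))
  ... | b₁ , b₁∈B , b₁a₁ , only₁ | b₂ , b₂∈B , b₂a₂ , only₂ | b₃ , b₃∈B , b₃a₃ , only₃ =
    ⊥-elim (obstruction-forbidden T free (lookup (z ∷ a₁ ∷ a₂ ∷ a₃ ∷ b₁ ∷ b₂ ∷ b₃ ∷ []))
      (a₁z ∷ a₂z ∷ a₃z ∷ zb₁ ∷ zb₂ ∷ zb₃ ∷ b₁a₁ ∷ b₂a₂ ∷ b₃a₃ ∷
       beats-private-target a₁∈ a₁z a₁≢a₂ zb₂ only₂ ∷
       beats-private-target a₁∈ a₁z a₁≢a₃ zb₃ only₃ ∷
       beats-private-target a₂∈ a₂z (≢-sym a₁≢a₂) zb₁ only₁ ∷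
       beats-private-target a₂∈ a₂z a₂≢a₃ zb₃ only₃ ∷
       beats-private-target a₃∈ a₃z (≢-sym a₁≢a₃) zb₁ only₁ ∷
       beats-private-target a₃∈ a₃z (≢-sym a₂≢a₃) zb₂ only₂ ∷ []))
    where
    a₁∈ : a₁ ∈ a₁ ∷ a₂ ∷ a₃ ∷ H
    a₁∈ = here refl
    a₂∈ : a₂ ∈ a₁ ∷ a₂ ∷ a₃ ∷ H
    a₂∈ = there (here refl)
    a₃∈ : a₃ ∈ a₁ ∷ a₂ ∷ a₃ ∷ H
    a₃∈ = there (there (here refl))
    a₁z : Arc T a₁ z
    a₁z = inA a₁∈
    a₂z : Arc T a₂ z
    a₂z = inA a₂∈
    a₃z : Arc T a₃ z
    a₃z = inA a₃∈
    zb₁ : Arc T z b₁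
    zb₁ = proj₁ (target b₁∈B)
    zb₂ : Arc T z b₂
    zb₂ = proj₁ (target b₂∈B)
    zb₃ : Arc T z b₃
    zb₃ = proj₁ (target b₃∈B)

lemma7 : ∀ {n : ℕ} (T : Tournament n) → 𝒯₇-free T → (z : Fin n) →
    TwoInDominates T (V T 2 z) (V T 3 z)
lemma7 {n} T free z
  with Cover.irredundant-subcover (Arc T) (arc? T) _≟_ (targets T z) (inNeighbours T z)
         (filter⁺ _ (allFin⁺ n)) (targets-covered T z)
... | H , H⊆A , unique , covers , private' =
  H , at-most-two T z free unique inA private' ,
  (λ _ a∈H → V₂-intro T z (inA a∈H)) , dominates
  where
  inA : ∀ {a} → a ∈ H → Arc T a z
  inA = in-neighbour T z ∘ H⊆A
  dominates : InDominates T (_∈ H) (V T 3 z)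
  dominates s s∈V₃ = find (All.lookup covers (V₃-target T z s∈V₃))
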